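{- Let $a_1,\ldots,a_n$ be nonnegative integers with $j$ entries equal to $0$, $k$ entries positive and even, and $l$ entries odd, $n=j+k+l$. If $j,k\ge0$ are even, $l\ge1$ is odd, and $k+l\ge3$, then $RT(a_1,\ldots,a_n)$ is super edge-graceful.
   Context: For a finite simple graph $G$ with $p$ vertices and $q$ edges, $G$ is super edge-graceful if there is a bijection $f$ from $E(G)$ onto $\{0,\pm1,\ldots,\pm\frac{q-1}{2}\}$ when $q$ is odd, and onto $\{\pm1,\ldots,\pm\frac{q}{2}\}$ when $q$ is even, such that the induced vertex labeling $f^+(v)=\sum_{uv\in E(G)} f(uv)$ is a bijection from $V(G)$ onto $\{0,\pm1,\ldots,\pm\frac{p-1}{2}\}$ when $p$ is odd, and onto $\{\pm1,\ldots,\pm\frac{p}{2}\}$ when $p$ is even. For nonnegative integers $a_1,\ldots,a_n$, $RT(a_1,\ldots,a_n)$ is the rooted tree with root $v_0$, children $v_1,\ldots,v_n$ of $v_0$, where $v_i$ has exactly $a_i$ children, all of which are leaves. -}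

module Defs where

open import Data.Nat using (ℕ; zero; suc; _+_; _*_; _∸_; _≤_; _<_; _≡ᵇ_)
open import Data.Nat.DivMod using (_%_; _/_)
open import Data.Integer as ℤ using (ℤ; ∣_∣)
open import Data.Fin using (Fin; toℕ)
open import Data.List using (List; []; _∷_; _++_; map; upTo; length; foldr; allFin)
open import Data.Nat.ListAction using (sum)
open import Data.Product using (_×_; _,_; proj₁; proj₂; ∃)
open import Data.Bool using (Bool; true; false; if_then_else_; _∨_)
open import Relation.Binary.PropositionalEquality using (_≡_; _≢_)
open import Function.Definitions using (Injective)

Even : ℕ → Set
Even m = m % 2 ≡ 0

Odd : ℕ → Set
Odd m = m % 2 ≡ 1

-- Finite graphs: p vertices named 0,…,p-1 and an indexed list of edges,
-- each edge a pair of vertex names.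

record Graph : Set where
  field
    p     : ℕ
    edges : List (ℕ × ℕ)

  q : ℕ
  q = length edges

  endpoints : Fin q → ℕ × ℕ
  endpoints e = Data.List.lookup edges e

open Graph public

SimpleGraph : Graph → Set
SimpleGraph G =
  (∀ e → proj₁ (endpoints G e) < p G × proj₂ (endpoints G e) < p G)
  × (∀ e → proj₁ (endpoints G e) ≢ proj₂ (endpoints G e))
  × (∀ e e' → ( (proj₁ (endpoints G e) ≡ proj₁ (endpoints G e') × proj₂ (endpoints G e) ≡ proj₂ (endpoints G e'))
              → e ≡ e')
            × ( (proj₁ (endpoints G e) ≡ proj₂ (endpoints G e') × proj₂ (endpoints G e) ≡ proj₁ (endpoints G e'))
              → e ≡ e'))

LabelSet : ℕ → ℤ → Set
LabelSet m z with m % 2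
... | 1 = ∣ z ∣ ≤ (m ∸ 1) / 2
... | _ = (z ≢ ℤ.0ℤ) × (∣ z ∣ ≤ m / 2)

BijOntoLabels : (m : ℕ) → (Fin m → ℤ) → Set
BijOntoLabels m f =
  (∀ i → LabelSet m (f i))
  × Injective _≡_ _≡_ f
  × (∀ z → LabelSet m z → ∃ λ i → f i ≡ z)

incident : ℕ → ℕ × ℕ → Bool
incident v (x , y) = (v ≡ᵇ x) ∨ (v ≡ᵇ y)

vertexSum : (G : Graph) → (Fin (q G) → ℤ) → ℕ → ℤ
vertexSum G f v =
  foldr ℤ._+_ ℤ.0ℤ
    (map (λ e → if incident v (endpoints G e) then f e else ℤ.0ℤ) (allFin (q G)))

SuperEdgeGraceful : Graph → Set
SuperEdgeGraceful G =
  ∃ λ (f : Fin (q G) → ℤ) →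
    BijOntoLabels (q G) f
    × BijOntoLabels (p G) (λ v → vertexSum G f (toℕ v))

-- The rooted tree RT(a₁,…,aₙ): root 0, children 1,…,n,
-- leaves of child i numbered consecutively from n+1 on.

rtEdges : (i next : ℕ) → List ℕ → List (ℕ × ℕ)
rtEdges i next [] = []
rtEdges i next (a ∷ as) =
  ((0 , i) ∷ map (λ t → (i , next + t)) (upTo a))
  ++ rtEdges (suc i) (next + a) as

RT : List ℕ → Graph
RT as = record
  { p     = 1 + length as + sum as
  ; edges = rtEdges 1 (1 + length as) as
  }

countZero : List ℕ → ℕ
countZero []      = 0
countZero (a ∷ as) with a
... | zero  = suc (countZero as)
... | suc _ = countZero as

countPosEven : List ℕ → ℕ
countPosEven [] = 0
countPosEven (zero ∷ as) = countPosEven as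
countPosEven (suc a ∷ as) with suc a % 2
... | 0 = suc (countPosEven as)
... | _ = countPosEven as

countOdd : List ℕ → ℕ
countOdd [] = 0
countOdd (a ∷ as) with a % 2
... | 1 = suc (countOdd as)
... | _ = countOdd as

module Submission where

-- The tree has q = n + Σ aᵢ edges and p = q + 1 vertices, so q = 2h is even
-- and the goal is: edge labels ±1,…,±h and vertex sums 0,±1,…,±h.  A leaf's
-- vertex sum is its own edge label, so it suffices that the root sum and the
-- child sums are 0 together with the spoke labels (superEdgeGraceful-RT).
-- Child i with aᵢ = 2h or 2h+1 gets 2h pendant labels ±m,…,±(m+h-1), which
-- sum to 0, from a running block.  The even children (2E of them) take the
-- spokes ±(l+1),…,±(l+E) in alternation.  The l = 2P+1 odd children are
-- served by an "odd gadget": spoke -l with leaf +l, and the pairs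
-- (±(2i+1), ∓2(P-i)), i < P, whose sums ±(4i+1-2P) are ±1,±3,…,±(2P-1)
-- again up to order (centredStep4).  The root then sums to -l, which
-- replaces the spoke label -l, and the child sum 0 is the remaining label.

open import Defs
open import Data.Nat as ℕ using (ℕ; zero; suc; _+_; _*_; _≤_; _<_; z≤n; s≤s; _≡ᵇ_; _≟_)
import Data.Nat.Properties as ℕP
import Data.Nat.Tactic.RingSolver as ℕSolver
open import Data.Nat.DivMod using (_%_; _/_; [m+kn]%n≡m%n; m*n%n≡0; m*n/n≡m; %-distribˡ-+)
open import Data.Nat.ListAction using (sum)
open import Data.Integer as ℤ using (ℤ; +_; -[1+_]; ∣_∣; -_)
import Data.Integer.Properties as ℤP
open import Data.Integer.Tactic.RingSolver using (solve-∀)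
open import Data.Fin using (Fin; toℕ) renaming (zero to fzero; suc to fsuc)
open import Data.List using (List; []; _∷_; _++_; map; length; tabulate; foldr; lookup; concat; applyUpTo; upTo)
import Data.List.Properties as ListP
open import Data.List.Membership.Propositional using (_∈_)
open import Data.List.Membership.Propositional.Properties using (∈-tabulate⁺; ∈-tabulate⁻)
open import Data.List.Relation.Unary.Any using (here; there)
open import Data.List.Relation.Unary.All as All using (All; []; _∷_)
open import Data.List.Relation.Unary.All.Properties using (tabulate⁻)
open import Data.List.Relation.Unary.AllPairs using ([]; _∷_)
open import Data.List.Relation.Unary.Unique.Propositional using (Unique)
open import Data.List.Relation.Binary.Permutation.Propositional
  using (_↭_; ↭-refl; ↭-sym; ↭-trans; ↭-prep; ↭-swap; ↭-reflexive; ↭⇒↭ₛ; module PermutationReasoning)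
open import Data.List.Relation.Binary.Permutation.Propositional.Properties
import Data.List.Relation.Binary.Permutation.Setoid.Properties as PermSetoid
open import Data.Product using (_×_; _,_; proj₁; proj₂; ∃)
open import Data.Sum using (_⊎_; inj₁; inj₂)
open import Data.Bool using (true; false; if_then_else_)
import Data.Bool.Properties as BoolP
open import Data.Empty using (⊥-elim)
open import Function using (_∘_)
open import Function.Bundles using (_⇔_; mk⇔; Equivalence)
open import Relation.Nullary.Decidable using (dec-true; dec-false)
open import Relation.Binary.PropositionalEquality

sumℤ : List ℤ → ℤ
sumℤ = foldr ℤ._+_ ℤ.0ℤ

sumℤ-++ : ∀ xs ys → sumℤ (xs ++ ys) ≡ sumℤ xs ℤ.+ sumℤ ys
sumℤ-++ []       ys = sym (ℤP.+-identityˡ (sumℤ ys))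
sumℤ-++ (x ∷ xs) ys = trans (cong (λ t → x ℤ.+ t) (sumℤ-++ xs ys)) (sym (ℤP.+-assoc x (sumℤ xs) (sumℤ ys)))

sumℤ-↭ : ∀ {xs ys} → xs ↭ ys → sumℤ xs ≡ sumℤ ys
sumℤ-↭ xs↭ys = PermSetoid.foldr-commMonoid (setoid ℤ) ℤP.+-0-isCommutativeMonoid (↭⇒↭ₛ xs↭ys)

pm : ℤ → List ℤ
pm x = x ∷ - x ∷ []

pairsBy : ℕ → ℕ → ℕ → List ℤ
pairsBy δ m zero    = []
pairsBy δ m (suc k) = + m ∷ - + m ∷ pairsBy δ (δ + m) k

symPairs : ℕ → ℕ → List ℤ
symPairs = pairsBy 1

symPairs-length : ∀ m k → length (symPairs m k) ≡ k + k
symPairs-length m zero    = refl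
symPairs-length m (suc k) =
  cong suc (trans (cong suc (symPairs-length (suc m) k)) (sym (ℕP.+-suc k k)))

pairsBy-snoc : ∀ δ m k → pairsBy δ m (suc k) ≡ pairsBy δ m k ++ pm (+ (k * δ + m))
pairsBy-snoc δ m zero    = refl
pairsBy-snoc δ m (suc k) = cong (λ xs → + m ∷ - + m ∷ xs)
  (trans (pairsBy-snoc δ (δ + m) k) (cong (λ n → pairsBy δ (δ + m) k ++ pm (+ n)) last≡))
  where
  last≡ : k * δ + (δ + m) ≡ suc k * δ + m
  last≡ = trans (sym (ℕP.+-assoc (k * δ) δ m)) (cong (_+ m) (ℕP.+-comm (k * δ) δ))

symPairs-++ : ∀ m a b → symPairs m (a + b) ≡ symPairs m a ++ symPairs (m + a) b
symPairs-++ m zero    b = cong (λ m′ → symPairs m′ b) (sym (ℕP.+-identityʳ m))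
symPairs-++ m (suc a) b = cong (λ xs → + m ∷ - + m ∷ xs)
  (trans (symPairs-++ (suc m) a b) (cong (λ m′ → symPairs (suc m) a ++ symPairs m′ b) (sym (ℕP.+-suc m a))))

pairsBy-sum : ∀ δ m k → sumℤ (pairsBy δ m k) ≡ ℤ.0ℤ
pairsBy-sum δ m zero    = refl
pairsBy-sum δ m (suc k) = begin
  + m ℤ.+ (- + m ℤ.+ sumℤ (pairsBy δ (δ + m) k)) ≡⟨ cong (λ t → + m ℤ.+ (- + m ℤ.+ t)) (pairsBy-sum δ (δ + m) k) ⟩
  + m ℤ.+ (- + m ℤ.+ ℤ.0ℤ)                       ≡⟨ cong (λ t → + m ℤ.+ t) (ℤP.+-identityʳ (- + m)) ⟩
  + m ℤ.+ - + m                                  ≡⟨ ℤP.+-inverseʳ (+ m) ⟩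
  ℤ.0ℤ                                           ∎
  where open ≡-Reasoning

symPairs-absorb : ∀ m h H {rest L} → rest ↭ L ++ symPairs (m + h) H → symPairs m h ++ rest ↭ L ++ symPairs m (h + H)
symPairs-absorb m h H {rest} {L} rest↭ = begin
  symPairs m h ++ rest                    ↭⟨ ++⁺ˡ (symPairs m h) rest↭ ⟩
  symPairs m h ++ L ++ symPairs (m + h) H ↭⟨ shifts (symPairs m h) L ⟩
  L ++ symPairs m h ++ symPairs (m + h) H ≡⟨ cong (L ++_) (symPairs-++ m h H) ⟨
  L ++ symPairs m (h + H)                 ∎
  where open PermutationReasoning

symPairs-interleave : ∀ m k → symPairs m (k + k) ↭ pairsBy 2 m k ++ pairsBy 2 (suc m) k
symPairs-interleave m zero    = ↭-refl
symPairs-interleave m (suc k) = begin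
  symPairs m (suc k + suc k)
    ≡⟨ cong (λ n → symPairs m (suc n)) (ℕP.+-suc k k) ⟩
  + m ∷ - + m ∷ + suc m ∷ - + suc m ∷ symPairs (2 + m) (k + k)
    ↭⟨ ↭-prep (+ m) (↭-prep (- + m) (++⁺ˡ (pm (+ suc m)) (symPairs-interleave (2 + m) k))) ⟩
  + m ∷ - + m ∷ pm (+ suc m) ++ pairsBy 2 (2 + m) k ++ pairsBy 2 (3 + m) k
    ↭⟨ ↭-prep (+ m) (↭-prep (- + m) (shifts (pm (+ suc m)) (pairsBy 2 (2 + m) k))) ⟩
  pairsBy 2 m (suc k) ++ pairsBy 2 (suc m) (suc k) ∎
  where open PermutationReasoning

symPairs-bounds : ∀ m k {z} → z ∈ symPairs m k → m ≤ ∣ z ∣ × ∣ z ∣ < m + k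
symPairs-bounds m (suc k) (here refl) = ℕP.≤-refl , ℕP.m<m+n m (s≤s z≤n)
symPairs-bounds m (suc k) (there (here refl)) rewrite ℤP.∣-i∣≡∣i∣ (+ m) = ℕP.≤-refl , ℕP.m<m+n m (s≤s z≤n)
symPairs-bounds m (suc k) {z} (there (there z∈)) with symPairs-bounds (suc m) k z∈
... | m<∣z∣ , ∣z∣<  = ℕP.<⇒≤ m<∣z∣ , subst (∣ z ∣ <_) (sym (ℕP.+-suc m k)) ∣z∣<

symPairs-complete : ∀ m k z → m ≤ ∣ z ∣ → ∣ z ∣ < m + k → z ∈ symPairs m k
symPairs-complete m zero    z m≤ <m+0 = ⊥-elim (ℕP.<⇒≱ (subst (∣ z ∣ <_) (ℕP.+-identityʳ m) <m+0) m≤)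
symPairs-complete m (suc k) z m≤ <m+k with ℕP.m≤n⇒m<n∨m≡n m≤
symPairs-complete m (suc k) (+ _)    m≤ <m+k | inj₂ refl = here refl
symPairs-complete m (suc k) -[1+ _ ] m≤ <m+k | inj₂ refl = there (here refl)
... | inj₁ m<∣z∣ = there (there (symPairs-complete (suc m) k z m<∣z∣ (subst (∣ z ∣ <_) (ℕP.+-suc m k) <m+k)))

symPairs-unique : ∀ m k → 1 ≤ m → Unique (symPairs m k)
symPairs-unique m       zero    _   = []
symPairs-unique (suc m) (suc k) _ =
  ((λ ()) ∷ later refl) ∷ later (ℤP.∣-i∣≡∣i∣ (+ suc m)) ∷ symPairs-unique (suc (suc m)) k (s≤s z≤n)
  where
  later : ∀ {x} → ∣ x ∣ ≡ suc m → All (x ≢_) (symPairs (suc (suc m)) k)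
  later ∣x∣≡ = All.tabulate λ y∈ x≡y →
    ℕP.<-irrefl (sym ∣x∣≡) (subst (λ w → suc m < ∣ w ∣) (sym x≡y) (proj₁ (symPairs-bounds _ k y∈)))

double≡*2 : ∀ h → h + h ≡ h ℕ.* 2
double≡*2 h = trans (cong (λ x → h + x) (sym (ℕP.+-identityʳ h))) (ℕP.*-comm 2 h)

double%2 : ∀ h → (h + h) % 2 ≡ 0
double%2 h rewrite double≡*2 h = m*n%n≡0 h 2

suc-double%2 : ∀ h → suc (h + h) % 2 ≡ 1
suc-double%2 h rewrite double≡*2 h = [m+kn]%n≡m%n 1 h 2

double/2 : ∀ h → (h + h) / 2 ≡ h
double/2 h rewrite double≡*2 h = m*n/n≡m h 2

labelSet-even : ∀ {m} h → m ≡ h + h → ∀ z → LabelSet m z ⇔ z ∈ symPairs 1 h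
labelSet-even h refl z rewrite double%2 h = mk⇔ to from
  where
  to : (z ≢ ℤ.0ℤ) × (∣ z ∣ ≤ (h + h) / 2) → z ∈ symPairs 1 h
  to (z≢0 , ∣z∣≤) = symPairs-complete 1 h z (nonzero z z≢0) (s≤s (subst (∣ z ∣ ≤_) (double/2 h) ∣z∣≤))
    where
    nonzero : ∀ z → z ≢ ℤ.0ℤ → 1 ≤ ∣ z ∣
    nonzero (+ zero)  z≢0 = ⊥-elim (z≢0 refl)
    nonzero (+ suc _) _   = s≤s z≤n
    nonzero -[1+ _ ]  _   = s≤s z≤n
  from : z ∈ symPairs 1 h → (z ≢ ℤ.0ℤ) × (∣ z ∣ ≤ (h + h) / 2)
  from z∈ with symPairs-bounds 1 h z∈
  ... | 1≤∣z∣ , ∣z∣<1+h =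
    (λ { refl → ℕP.<-irrefl refl 1≤∣z∣ }) , subst (∣ z ∣ ≤_) (sym (double/2 h)) (ℕP.≤-pred ∣z∣<1+h)

labelSet-odd : ∀ {m} h → m ≡ suc (h + h) → ∀ z → LabelSet m z ⇔ z ∈ ℤ.0ℤ ∷ symPairs 1 h
labelSet-odd h refl z rewrite suc-double%2 h = mk⇔ (to z) from
  where
  to : ∀ z → ∣ z ∣ ≤ (h + h) / 2 → z ∈ ℤ.0ℤ ∷ symPairs 1 h
  to (+ zero) _ = here refl
  to z@(+ suc _) ∣z∣≤ = there (symPairs-complete 1 h z (s≤s z≤n) (s≤s (subst (∣ z ∣ ≤_) (double/2 h) ∣z∣≤)))
  to z@(-[1+ _ ]) ∣z∣≤ = there (symPairs-complete 1 h z (s≤s z≤n) (s≤s (subst (∣ z ∣ ≤_) (double/2 h) ∣z∣≤)))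
  from : z ∈ ℤ.0ℤ ∷ symPairs 1 h → ∣ z ∣ ≤ (h + h) / 2
  from (here refl) = z≤n
  from (there z∈) = subst (∣ z ∣ ≤_) (sym (double/2 h)) (ℕP.≤-pred (proj₂ (symPairs-bounds 1 h z∈)))

unique-tabulate-injective : ∀ {m} (g : Fin m → ℤ) → Unique (tabulate g) → ∀ {i j} → g i ≡ g j → i ≡ j
unique-tabulate-injective g (_ ∷ _) {fzero} {fzero} _ = refl
unique-tabulate-injective g (g0∉ ∷ _) {fzero} {fsuc j} e = ⊥-elim (tabulate⁻ g0∉ j e)
unique-tabulate-injective g (g0∉ ∷ _) {fsuc i} {fzero} e = ⊥-elim (tabulate⁻ g0∉ i (sym e))
unique-tabulate-injective g (_ ∷ u) {fsuc i} {fsuc j} e = cong fsuc (unique-tabulate-injective (λ k → g (fsuc k)) u e)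

bijOntoLabels-↭ : ∀ m (g : Fin m → ℤ) C → tabulate g ↭ C → Unique C →
                  (∀ z → LabelSet m z ⇔ z ∈ C) → BijOntoLabels m g
bijOntoLabels-↭ m g C tab↭C uniqueC labels =
  (λ i → Equivalence.from (labels (g i)) (∈-resp-↭ tab↭C (∈-tabulate⁺ i)))
  , unique-tabulate-injective g (PermSetoid.Unique-resp-↭ (setoid ℤ) (↭⇒↭ₛ (↭-sym tab↭C)) uniqueC)
  , λ z z∈ → let (i , z≡gi) = ∈-tabulate⁻ (∈-resp-↭ (↭-sym tab↭C) (Equivalence.to (labels z) z∈)) in i , sym z≡gi

LabelledEdge : Set
LabelledEdge = (ℕ × ℕ) × ℤ

labelledGraph : ℕ → List LabelledEdge → Graph
labelledGraph n es = record { p = n ; edges = map proj₁ es }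

labelOf : (es : List LabelledEdge) → Fin (length (map proj₁ es)) → ℤ
labelOf (e ∷ es) fzero    = proj₂ e
labelOf (e ∷ es) (fsuc i) = labelOf es i

incidentLabel : ℕ → LabelledEdge → ℤ
incidentLabel v e = if incident v (proj₁ e) then proj₂ e else ℤ.0ℤ

incidentSum : ℕ → List LabelledEdge → ℤ
incidentSum v es = sumℤ (map (incidentLabel v) es)

tabulate-labelOf : ∀ es (K : ℕ × ℕ → ℤ → ℤ) →
  tabulate (λ i → K (lookup (map proj₁ es) i) (labelOf es i)) ≡ map (λ e → K (proj₁ e) (proj₂ e)) es
tabulate-labelOf []       K = refl
tabulate-labelOf (e ∷ es) K = cong (_ ∷_) (tabulate-labelOf es K)

vertexSum-labelled : ∀ n es v → vertexSum (labelledGraph n es) (labelOf es) v ≡ incidentSum v es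
vertexSum-labelled n es v =
  cong sumℤ (trans (ListP.map-tabulate (λ i → i) _) (tabulate-labelOf es (λ e l → if incident v e then l else ℤ.0ℤ)))

range : ℕ → ℕ → List ℕ
range k zero    = []
range k (suc n) = k ∷ range (suc k) n

tabulate-range : ∀ n k (F : ℕ → ℤ) → tabulate {n = n} (λ i → F (k + toℕ i)) ≡ map F (range k n)
tabulate-range zero    k F = refl
tabulate-range (suc n) k F = cong₂ _∷_ (cong F (ℕP.+-identityʳ k))
  (trans (ListP.tabulate-cong (λ i → cong F (ℕP.+-suc k (toℕ i)))) (tabulate-range n (suc k) F))

range-++ : ∀ k m n → range k (m + n) ≡ range k m ++ range (k + m) n
range-++ k zero    n = cong (λ k′ → range k′ n) (sym (ℕP.+-identityʳ k))
range-++ k (suc m) n = cong (k ∷_)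
  (trans (range-++ (suc k) m n) (cong (λ k′ → range (suc k) m ++ range k′ n) (sym (ℕP.+-suc k m))))

map-range-cong : ∀ k n {F G : ℕ → ℤ} → (∀ v → k ≤ v → v < k + n → F v ≡ G v) →
  map F (range k n) ≡ map G (range k n)
map-range-cong k zero    F≗G = refl
map-range-cong k (suc n) F≗G = cong₂ _∷_ (F≗G k ℕP.≤-refl (ℕP.m<m+n k (s≤s z≤n)))
  (map-range-cong (suc k) n (λ v k<v v< → F≗G v (ℕP.<⇒≤ k<v) (subst (v <_) (sym (ℕP.+-suc k n)) v<)))

superEdgeGraceful-criterion : ∀ n es h →
  map proj₂ es ↭ symPairs 1 h →
  map (λ v → incidentSum v es) (range 0 n) ↭ ℤ.0ℤ ∷ symPairs 1 h →
  SuperEdgeGraceful (labelledGraph n es)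
superEdgeGraceful-criterion n es h edges↭ vertices↭ =
  labelOf es
  , bijOntoLabels-↭ (length (map proj₁ es)) (labelOf es) (symPairs 1 h) edgeTable
      (symPairs-unique 1 h (s≤s z≤n)) (labelSet-even h edgeCount≡)
  , bijOntoLabels-↭ n vertexLabel (ℤ.0ℤ ∷ symPairs 1 h) vertexTable
      (zeroFresh ∷ symPairs-unique 1 h (s≤s z≤n)) (labelSet-odd h vertexCount≡)
  where
  edgeTable : tabulate (labelOf es) ↭ symPairs 1 h
  edgeTable = ↭-trans (↭-reflexive (tabulate-labelOf es (λ _ l → l))) edges↭
  edgeCount≡ : length (map proj₁ es) ≡ h + h
  edgeCount≡ = trans (sym (ListP.length-tabulate (labelOf es))) (trans (↭-length edgeTable) (symPairs-length 1 h))
  vertexLabel : Fin n → ℤ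
  vertexLabel v = vertexSum (labelledGraph n es) (labelOf es) (toℕ v)
  vertexTable : tabulate vertexLabel ↭ ℤ.0ℤ ∷ symPairs 1 h
  vertexTable = ↭-trans (↭-reflexive (trans (ListP.tabulate-cong (λ v → vertexSum-labelled n es (toℕ v)))
                                            (tabulate-range n 0 (λ v → incidentSum v es))))
                        vertices↭
  vertexCount≡ : n ≡ suc (h + h)
  vertexCount≡ = trans (sym (ListP.length-tabulate vertexLabel)) (trans (↭-length vertexTable) (cong suc (symPairs-length 1 h)))
  zeroFresh : All (ℤ.0ℤ ≢_) (symPairs 1 h)
  zeroFresh = All.tabulate λ z∈ 0≡z →
    ℕP.<-irrefl refl (subst (λ w → 0 < ∣ w ∣) (sym 0≡z) (proj₁ (symPairs-bounds 1 h z∈)))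

incident-neither : ∀ {v x y} → v ≢ x → v ≢ y → incident v (x , y) ≡ false
incident-neither {v} {x} {y} v≢x v≢y rewrite dec-false (v ≟ x) v≢x | dec-false (v ≟ y) v≢y = refl

incident-left : ∀ v y → incident v (v , y) ≡ true
incident-left v y rewrite dec-true (v ≟ v) refl = refl

incident-right : ∀ v x → incident v (x , v) ≡ true
incident-right v x rewrite dec-true (v ≟ v) refl = BoolP.∨-zeroʳ (v ≡ᵇ x)

incidentSum-++ : ∀ v xs ys → incidentSum v (xs ++ ys) ≡ incidentSum v xs ℤ.+ incidentSum v ys
incidentSum-++ v xs ys = trans (cong sumℤ (ListP.map-++ (incidentLabel v) xs ys)) (sumℤ-++ (map (incidentLabel v) xs) _)

Branch : Set
Branch = ℤ × List ℤ

spoke : Branch → ℤ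
spoke = proj₁

leafLabels : Branch → List ℤ
leafLabels = proj₂

branchSizes : List Branch → List ℕ
branchSizes = map (λ b → length (leafLabels b))

leafEdges : ℕ → ℕ → List ℤ → List LabelledEdge
leafEdges i nx []       = []
leafEdges i nx (l ∷ ls) = ((i , nx) , l) ∷ leafEdges i (suc nx) ls

branchEdges : ℕ → ℕ → Branch → List LabelledEdge
branchEdges i nx (s , ls) = ((0 , i) , s) ∷ leafEdges i nx ls

treeEdges : ℕ → ℕ → List Branch → List LabelledEdge
treeEdges i nx []       = []
treeEdges i nx (b ∷ bs) = branchEdges i nx b ++ treeEdges (suc i) (nx + length (leafLabels b)) bs

leafEdges-shape : ∀ i nx ls (f : ℕ → ℕ × ℕ) → (∀ t → f t ≡ (i , nx + t)) →
  map proj₁ (leafEdges i nx ls) ≡ applyUpTo f (length ls)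
leafEdges-shape i nx []       f f≗ = refl
leafEdges-shape i nx (l ∷ ls) f f≗ =
  cong₂ _∷_ (trans (cong (i ,_) (sym (ℕP.+-identityʳ nx))) (sym (f≗ 0)))
            (leafEdges-shape i (suc nx) ls (λ t → f (suc t)) (λ t → trans (f≗ (suc t)) (cong (i ,_) (ℕP.+-suc nx t))))

treeEdges-shape : ∀ i nx bs → map proj₁ (treeEdges i nx bs) ≡ rtEdges i nx (branchSizes bs)
treeEdges-shape i nx []              = refl
treeEdges-shape i nx ((s , ls) ∷ bs) = begin
  map proj₁ (branchEdges i nx (s , ls) ++ rest)
    ≡⟨ cong ((0 , i) ∷_) (ListP.map-++ proj₁ (leafEdges i nx ls) rest) ⟩
  (0 , i) ∷ map proj₁ (leafEdges i nx ls) ++ map proj₁ rest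
    ≡⟨ cong₂ (λ xs ys → (0 , i) ∷ xs ++ ys) leaves (treeEdges-shape (suc i) (nx + length ls) bs) ⟩
  rtEdges i nx (branchSizes ((s , ls) ∷ bs)) ∎
  where
  open ≡-Reasoning
  rest = treeEdges (suc i) (nx + length ls) bs
  leaves : map proj₁ (leafEdges i nx ls) ≡ map (λ t → (i , nx + t)) (upTo (length ls))
  leaves = trans (leafEdges-shape i nx ls _ (λ t → refl)) (sym (ListP.map-upTo _ (length ls)))

Outside : ℕ → ℕ → ℕ → Set
Outside v lo len = v < lo ⊎ lo + len ≤ v

outside-≢ : ∀ {v lo n} → Outside v lo (suc n) → v ≢ lo
outside-≢ (inj₁ v<lo) refl = ℕP.<-irrefl refl v<lo
outside-≢ {lo = lo} (inj₂ lo+n<v) refl = ℕP.<-irrefl refl (ℕP.<-≤-trans (ℕP.m<m+n lo (s≤s z≤n)) lo+n<v)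

outside-suc : ∀ {v lo n} → Outside v lo (suc n) → Outside v (suc lo) n
outside-suc (inj₁ v<lo) = inj₁ (ℕP.m<n⇒m<1+n v<lo)
outside-suc {v} {lo} {n} (inj₂ ≤v) = inj₂ (subst (_≤ v) (ℕP.+-suc lo n) ≤v)

outside-split : ∀ {v lo} m n → Outside v lo (m + n) → Outside v lo m × Outside v (lo + m) n
outside-split {lo = lo} m n (inj₁ v<lo) = inj₁ v<lo , inj₁ (ℕP.<-≤-trans v<lo (ℕP.m≤m+n lo m))
outside-split {v} {lo} m n (inj₂ ≤v) = inj₂ (ℕP.≤-trans (ℕP.m≤m+n (lo + m) n) lo+m+n≤v) , inj₂ lo+m+n≤v
  where
  lo+m+n≤v : lo + m + n ≤ v
  lo+m+n≤v = subst (_≤ v) (sym (ℕP.+-assoc lo m n)) ≤v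

above⇒≢0 : ∀ {u v} → u < v → v ≢ 0
above⇒≢0 u<v = ℕP.>⇒≢ (ℕP.≤-<-trans z≤n u<v)

leafEdges-miss : ∀ {v} i nx ls → v ≢ i → Outside v nx (length ls) → incidentSum v (leafEdges i nx ls) ≡ ℤ.0ℤ
leafEdges-miss i nx []       v≢i out = refl
leafEdges-miss i nx (l ∷ ls) v≢i out rewrite incident-neither v≢i (outside-≢ out) =
  trans (ℤP.+-identityˡ _) (leafEdges-miss i (suc nx) ls v≢i (outside-suc out))

branchEdges-miss : ∀ {v} i nx b → v ≢ 0 → v ≢ i → Outside v nx (length (leafLabels b)) →
  incidentSum v (branchEdges i nx b) ≡ ℤ.0ℤ
branchEdges-miss i nx (s , ls) v≢0 v≢i out rewrite incident-neither v≢0 v≢i =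
  trans (ℤP.+-identityˡ _) (leafEdges-miss i nx ls v≢i out)

treeEdges-miss : ∀ {v} i nx bs → v ≢ 0 → Outside v i (length bs) → Outside v nx (sum (branchSizes bs)) →
  incidentSum v (treeEdges i nx bs) ≡ ℤ.0ℤ
treeEdges-miss i nx []       v≢0 outC outL = refl
treeEdges-miss {v} i nx (b ∷ bs) v≢0 outC outL
  with outB , outR ← outside-split (length (leafLabels b)) (sum (branchSizes bs)) outL = begin
  incidentSum v (branchEdges i nx b ++ rest)
    ≡⟨ incidentSum-++ v (branchEdges i nx b) rest ⟩
  incidentSum v (branchEdges i nx b) ℤ.+ incidentSum v rest
    ≡⟨ cong₂ ℤ._+_ (branchEdges-miss i nx b v≢0 (outside-≢ outC) outB)
                   (treeEdges-miss (suc i) _ bs v≢0 (outside-suc outC) outR) ⟩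
  ℤ.0ℤ ∎
  where
  open ≡-Reasoning
  rest = treeEdges (suc i) (nx + length (leafLabels b)) bs

leafEdges-centre : ∀ i nx ls → incidentSum i (leafEdges i nx ls) ≡ sumℤ ls
leafEdges-centre i nx []       = refl
leafEdges-centre i nx (l ∷ ls) rewrite incident-left i nx = cong (λ t → l ℤ.+ t) (leafEdges-centre i (suc nx) ls)

leafEdges-leaves : ∀ i nx ls → i < nx → map (λ v → incidentSum v (leafEdges i nx ls)) (range nx (length ls)) ≡ ls
leafEdges-leaves i nx []       i<nx = refl
leafEdges-leaves i nx (l ∷ ls) i<nx = cong₂ _∷_ first others
  where
  first : incidentSum nx (leafEdges i nx (l ∷ ls)) ≡ l
  first rewrite incident-right nx i | leafEdges-miss i (suc nx) ls (ℕP.>⇒≢ i<nx) (inj₁ (ℕP.n<1+n nx)) = ℤP.+-identityʳ l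
  others : map (λ v → incidentSum v (leafEdges i nx (l ∷ ls))) (range (suc nx) (length ls)) ≡ ls
  others = trans (map-range-cong (suc nx) (length ls) skip) (leafEdges-leaves i (suc nx) ls (ℕP.m<n⇒m<1+n i<nx))
    where
    skip : ∀ v → suc nx ≤ v → v < suc nx + length ls →
      incidentSum v (leafEdges i nx (l ∷ ls)) ≡ incidentSum v (leafEdges i (suc nx) ls)
    skip v nx<v _ rewrite incident-neither (ℕP.>⇒≢ (ℕP.<-trans i<nx nx<v)) (ℕP.>⇒≢ nx<v) = ℤP.+-identityˡ _

branchSum : Branch → ℤ
branchSum (s , ls) = s ℤ.+ sumℤ ls

treeEdges-root : ∀ i nx bs → incidentSum 0 (treeEdges (suc i) (suc nx) bs) ≡ sumℤ (map spoke bs)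
treeEdges-root i nx []              = refl
treeEdges-root i nx ((s , ls) ∷ bs) = begin
  incidentSum 0 (branchEdges (suc i) (suc nx) (s , ls) ++ rest)
    ≡⟨ incidentSum-++ 0 (branchEdges (suc i) (suc nx) (s , ls)) rest ⟩
  (s ℤ.+ incidentSum 0 (leafEdges (suc i) (suc nx) ls)) ℤ.+ incidentSum 0 rest
    ≡⟨ cong₂ (λ x y → (s ℤ.+ x) ℤ.+ y) (leafEdges-miss (suc i) (suc nx) ls (λ ()) (inj₁ (s≤s z≤n)))
                                       (treeEdges-root (suc i) (nx + length ls) bs) ⟩
  (s ℤ.+ ℤ.0ℤ) ℤ.+ sumℤ (map spoke bs)
    ≡⟨ cong (ℤ._+ sumℤ (map spoke bs)) (ℤP.+-identityʳ s) ⟩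
  s ℤ.+ sumℤ (map spoke bs) ∎
  where
  open ≡-Reasoning
  rest = treeEdges (suc (suc i)) (suc nx + length ls) bs

treeEdges-children : ∀ i nx bs → 1 ≤ i → i + length bs ≤ nx →
  map (λ v → incidentSum v (treeEdges i nx bs)) (range i (length bs)) ≡ map branchSum bs
treeEdges-children i nx []              _   _   = refl
treeEdges-children i nx ((s , ls) ∷ bs) 1≤i fits = cong₂ _∷_ own others
  where
  rest = treeEdges (suc i) (nx + length ls) bs
  i<nx : i < nx
  i<nx = ℕP.<-≤-trans (ℕP.m<m+n i (s≤s z≤n)) fits
  fits′ : suc i + length bs ≤ nx
  fits′ = subst (_≤ nx) (ℕP.+-suc i (length bs)) fits
  own : incidentSum i (branchEdges i nx (s , ls) ++ rest) ≡ branchSum (s , ls)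
  own rewrite incidentSum-++ i (branchEdges i nx (s , ls)) rest
            | incident-right i 0 | leafEdges-centre i nx ls
            | treeEdges-miss (suc i) (nx + length ls) bs (ℕP.>⇒≢ 1≤i) (inj₁ (ℕP.n<1+n i))
                (inj₁ (ℕP.<-≤-trans i<nx (ℕP.m≤m+n nx (length ls))))
            = ℤP.+-identityʳ _
  others : map (λ v → incidentSum v (branchEdges i nx (s , ls) ++ rest)) (range (suc i) (length bs)) ≡ map branchSum bs
  others = trans (map-range-cong (suc i) (length bs) skip)
                 (treeEdges-children (suc i) (nx + length ls) bs (s≤s z≤n) (ℕP.≤-trans fits′ (ℕP.m≤m+n nx _)))
    where
    skip : ∀ v → suc i ≤ v → v < suc i + length bs →
      incidentSum v (branchEdges i nx (s , ls) ++ rest) ≡ incidentSum v rest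
    skip v i<v v< rewrite incidentSum-++ v (branchEdges i nx (s , ls)) rest
                        | branchEdges-miss i nx (s , ls) (above⇒≢0 i<v) (ℕP.>⇒≢ i<v)
                            (inj₁ (ℕP.<-≤-trans v< fits′))
                        = ℤP.+-identityˡ _

treeEdges-leaves : ∀ i nx bs → 1 ≤ i → i + length bs ≤ nx →
  map (λ v → incidentSum v (treeEdges i nx bs)) (range nx (sum (branchSizes bs))) ≡ concat (map leafLabels bs)
treeEdges-leaves i nx []              _   _    = refl
treeEdges-leaves i nx ((s , ls) ∷ bs) 1≤i fits = begin
  map F (range nx (length ls + sum (branchSizes bs)))
    ≡⟨ cong (map F) (range-++ nx (length ls) _) ⟩
  map F (range nx (length ls) ++ range (nx + length ls) (sum (branchSizes bs)))
    ≡⟨ ListP.map-++ F (range nx (length ls)) _ ⟩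
  map F (range nx (length ls)) ++ map F (range (nx + length ls) (sum (branchSizes bs)))
    ≡⟨ cong₂ _++_ own later ⟩
  ls ++ concat (map leafLabels bs) ∎
  where
  open ≡-Reasoning
  rest = treeEdges (suc i) (nx + length ls) bs
  F = λ v → incidentSum v (branchEdges i nx (s , ls) ++ rest)
  i<nx : i < nx
  i<nx = ℕP.<-≤-trans (ℕP.m<m+n i (s≤s z≤n)) fits
  fits′ : suc i + length bs ≤ nx
  fits′ = subst (_≤ nx) (ℕP.+-suc i (length bs)) fits
  own : map F (range nx (length ls)) ≡ ls
  own = trans (map-range-cong nx (length ls) skip) (leafEdges-leaves i nx ls i<nx)
    where
    i<v : ∀ {v} → nx ≤ v → i < v
    i<v = ℕP.<-≤-trans i<nx
    skip : ∀ v → nx ≤ v → v < nx + length ls → F v ≡ incidentSum v (leafEdges i nx ls)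
    skip v nx≤v v< rewrite incidentSum-++ v (branchEdges i nx (s , ls)) rest
                         | treeEdges-miss (suc i) (nx + length ls) bs (above⇒≢0 (i<v nx≤v))
                             (inj₂ (ℕP.≤-trans fits′ nx≤v)) (inj₁ v<)
                         | incident-neither (above⇒≢0 (i<v nx≤v)) (ℕP.>⇒≢ (i<v nx≤v))
                         = trans (ℤP.+-identityʳ _) (ℤP.+-identityˡ _)
  later : map F (range (nx + length ls) (sum (branchSizes bs))) ≡ concat (map leafLabels bs)
  later = trans (map-range-cong (nx + length ls) _ skip)
                (treeEdges-leaves (suc i) (nx + length ls) bs (s≤s z≤n) (ℕP.≤-trans fits′ (ℕP.m≤m+n nx _)))
    where
    i<v : ∀ {v} → nx + length ls ≤ v → i < v
    i<v ≤v = ℕP.<-≤-trans i<nx (ℕP.≤-trans (ℕP.m≤m+n nx (length ls)) ≤v)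
    skip : ∀ v → nx + length ls ≤ v → v < nx + length ls + sum (branchSizes bs) → F v ≡ incidentSum v rest
    skip v ≤v _ rewrite incidentSum-++ v (branchEdges i nx (s , ls)) rest
                      | branchEdges-miss i nx (s , ls) (above⇒≢0 (i<v ≤v)) (ℕP.>⇒≢ (i<v ≤v)) (inj₂ ≤v)
                      = ℤP.+-identityˡ _

treeEdgeLabels : ∀ i nx bs → map proj₂ (treeEdges i nx bs) ↭ map spoke bs ++ concat (map leafLabels bs)
treeEdgeLabels i nx []              = ↭-refl
treeEdgeLabels i nx ((s , ls) ∷ bs) = begin
  s ∷ map proj₂ (leafEdges i nx ls ++ rest)
    ≡⟨ cong (s ∷_) (trans (ListP.map-++ proj₂ (leafEdges i nx ls) rest) (cong (_++ map proj₂ rest) (leafLabels≡ i nx ls))) ⟩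
  s ∷ ls ++ map proj₂ rest
    ↭⟨ ↭-prep s (++⁺ˡ ls (treeEdgeLabels (suc i) (nx + length ls) bs)) ⟩
  s ∷ ls ++ map spoke bs ++ concat (map leafLabels bs)
    ↭⟨ ↭-prep s (shifts ls (map spoke bs)) ⟩
  s ∷ map spoke bs ++ ls ++ concat (map leafLabels bs) ∎
  where
  open PermutationReasoning
  rest = treeEdges (suc i) (nx + length ls) bs
  leafLabels≡ : ∀ i nx ls → map proj₂ (leafEdges i nx ls) ≡ ls
  leafLabels≡ i nx []       = refl
  leafLabels≡ i nx (l ∷ ls) = cong (l ∷_) (leafLabels≡ i (suc nx) ls)

treeVertexSums : ∀ bs →
  map (λ v → incidentSum v (treeEdges 1 (suc (length bs)) bs)) (range 0 (suc (length bs + sum (branchSizes bs))))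
  ≡ sumℤ (map spoke bs) ∷ map branchSum bs ++ concat (map leafLabels bs)
treeVertexSums bs = cong₂ _∷_ (treeEdges-root 0 (length bs) bs) (begin
  map F (range 1 (length bs + sum (branchSizes bs)))
    ≡⟨ cong (map F) (range-++ 1 (length bs) _) ⟩
  map F (range 1 (length bs) ++ range (suc (length bs)) (sum (branchSizes bs)))
    ≡⟨ ListP.map-++ F (range 1 (length bs)) _ ⟩
  map F (range 1 (length bs)) ++ map F (range (suc (length bs)) (sum (branchSizes bs)))
    ≡⟨ cong₂ _++_ (treeEdges-children 1 _ bs ℕP.≤-refl ℕP.≤-refl) (treeEdges-leaves 1 _ bs ℕP.≤-refl ℕP.≤-refl) ⟩
  map branchSum bs ++ concat (map leafLabels bs) ∎)
  where
  open ≡-Reasoning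
  F = λ v → incidentSum v (treeEdges 1 (suc (length bs)) bs)

superEdgeGraceful-RT : ∀ bs h →
  map spoke bs ++ concat (map leafLabels bs) ↭ symPairs 1 h →
  sumℤ (map spoke bs) ∷ map branchSum bs ↭ ℤ.0ℤ ∷ map spoke bs →
  SuperEdgeGraceful (RT (branchSizes bs))
superEdgeGraceful-RT bs h edges↭ inner↭ =
  subst SuperEdgeGraceful labelledGraph≡RT (superEdgeGraceful-criterion vertices es h edgeLabels↭ vertexSums↭)
  where
  open PermutationReasoning
  n = length bs
  leaves = concat (map leafLabels bs)
  vertices = suc (n + sum (branchSizes bs))
  es = treeEdges 1 (suc n) bs
  labelledGraph≡RT : labelledGraph vertices es ≡ RT (branchSizes bs)
  labelledGraph≡RT = cong₂ (λ n′ edges → record { p = suc (n′ + sum (branchSizes bs)) ; edges = edges })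
    (sym (ListP.length-map _ bs))
    (trans (treeEdges-shape 1 (suc n) bs) (cong (λ n′ → rtEdges 1 (suc n′) (branchSizes bs)) (sym (ListP.length-map _ bs))))
  edgeLabels↭ : map proj₂ es ↭ symPairs 1 h
  edgeLabels↭ = ↭-trans (treeEdgeLabels 1 (suc n) bs) edges↭
  vertexSums↭ : map (λ v → incidentSum v es) (range 0 vertices) ↭ ℤ.0ℤ ∷ symPairs 1 h
  vertexSums↭ = begin
    map (λ v → incidentSum v es) (range 0 vertices)     ≡⟨ treeVertexSums bs ⟩
    (sumℤ (map spoke bs) ∷ map branchSum bs) ++ leaves ↭⟨ ++⁺ʳ leaves inner↭ ⟩
    ℤ.0ℤ ∷ map spoke bs ++ leaves                     ↭⟨ ↭-prep ℤ.0ℤ edges↭ ⟩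
    ℤ.0ℤ ∷ symPairs 1 h ∎

data Parity : ℕ → Set where
  even : ∀ h → Parity (h + h)
  odd  : ∀ h → Parity (suc (h + h))

parity : ∀ n → Parity n
parity zero          = even 0
parity (suc zero)    = odd 0
parity (suc (suc n)) with parity n
... | even h = subst Parity (cong suc (ℕP.+-suc h h)) (even (suc h))
... | odd h  = subst Parity (cong (suc ∘ suc) (ℕP.+-suc h h)) (odd (suc h))

oddCount : List ℕ → ℕ
oddCount []       = 0
oddCount (a ∷ as) with parity a
... | even _ = oddCount as
... | odd _  = suc (oddCount as)

evenCount : List ℕ → ℕ
evenCount []       = 0
evenCount (a ∷ as) with parity a
... | even _ = suc (evenCount as)
... | odd _  = evenCount as

halfSum : List ℕ → ℕ
halfSum []       = 0
halfSum (a ∷ as) with parity a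
... | even h = h + halfSum as
... | odd h  = h + halfSum as

-- Child i with aᵢ = 2h or 2h+1 takes its spoke label
-- from one of two supplies: an even child the next value of `evens`; an odd
-- child the next pair (spoke, leaf) of `odds`, that leaf label going to one of
-- its pendant edges.  The remaining 2h pendant edges get ±m, …, ±(m+h-1),
-- m counting upwards along the list.
assign : (ℕ → ℤ × ℤ) → (ℕ → ℤ) → ℕ → List ℕ → List Branch
assign odds evens m []       = []
assign odds evens m (a ∷ as) with parity a
... | even h = (evens 0 , symPairs m h) ∷ assign odds (evens ∘ suc) (m + h) as
... | odd h  = (proj₁ (odds 0) , proj₂ (odds 0) ∷ symPairs m h) ∷ assign (odds ∘ suc) evens (m + h) as

assign-sizes : ∀ odds evens m as → branchSizes (assign odds evens m as) ≡ as
assign-sizes odds evens m []       = refl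
assign-sizes odds evens m (a ∷ as) with parity a
... | even h = cong₂ _∷_ (symPairs-length m h) (assign-sizes odds (evens ∘ suc) (m + h) as)
... | odd h  = cong₂ _∷_ (cong suc (symPairs-length m h)) (assign-sizes (odds ∘ suc) evens (m + h) as)

assign-spokes : ∀ odds evens m as →
  map spoke (assign odds evens m as) ↭ map proj₁ (applyUpTo odds (oddCount as)) ++ applyUpTo evens (evenCount as)
assign-spokes odds evens m []       = ↭-refl
assign-spokes odds evens m (a ∷ as) with parity a
... | even h = ↭-trans (↭-prep (evens 0) (assign-spokes odds (evens ∘ suc) (m + h) as))
                       (↭-sym (shift (evens 0) (map proj₁ (applyUpTo odds (oddCount as))) _))
... | odd h  = ↭-prep (proj₁ (odds 0)) (assign-spokes (odds ∘ suc) evens (m + h) as)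

assign-leaves : ∀ odds evens m as →
  concat (map leafLabels (assign odds evens m as)) ↭ map proj₂ (applyUpTo odds (oddCount as)) ++ symPairs m (halfSum as)
assign-leaves odds evens m []       = ↭-refl
assign-leaves odds evens m (a ∷ as) with parity a
... | even h = symPairs-absorb m h (halfSum as) (assign-leaves odds (evens ∘ suc) (m + h) as)
... | odd h  = ↭-prep (proj₂ (odds 0)) (symPairs-absorb m h (halfSum as) (assign-leaves (odds ∘ suc) evens (m + h) as))

pairSum : ℤ × ℤ → ℤ
pairSum (s , g) = s ℤ.+ g

-- Since each ±-block sums to 0, the child sums are those of the supplies.
assign-branchSums : ∀ odds evens m as →
  map branchSum (assign odds evens m as) ↭ map pairSum (applyUpTo odds (oddCount as)) ++ applyUpTo evens (evenCount as)
assign-branchSums odds evens m []       = ↭-refl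
assign-branchSums odds evens m (a ∷ as) with parity a
... | even h rewrite pairsBy-sum 1 m h | ℤP.+-identityʳ (evens 0) =
  ↭-trans (↭-prep (evens 0) (assign-branchSums odds (evens ∘ suc) (m + h) as))
          (↭-sym (shift (evens 0) (map pairSum (applyUpTo odds (oddCount as))) _))
... | odd h  rewrite pairsBy-sum 1 m h | ℤP.+-identityʳ (proj₂ (odds 0)) =
  ↭-prep (pairSum (odds 0)) (assign-branchSums (odds ∘ suc) evens (m + h) as)

-- The j-th entry of a list (d past its end), turning a finite list into a supply.
entry : {A : Set} → A → List A → ℕ → A
entry d []       j       = d
entry d (x ∷ xs) zero    = x
entry d (x ∷ xs) (suc j) = entry d xs j

applyUpTo-entry : ∀ {A : Set} (d : A) xs → applyUpTo (entry d xs) (length xs) ≡ xs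
applyUpTo-entry d []       = refl
applyUpTo-entry d (x ∷ xs) = cong (x ∷_) (applyUpTo-entry d xs)

record IsOddGadget (l : ℕ) (G : List (ℤ × ℤ)) : Set where
  field
    size   : length G ≡ l
    labels : map proj₁ G ++ map proj₂ G ↭ symPairs 1 l
    sums   : sumℤ (map proj₁ G) ∷ map pairSum G ↭ ℤ.0ℤ ∷ map proj₁ G

superEdgeGraceful-from-gadget : ∀ as G E → IsOddGadget (oddCount as) G → evenCount as ≡ E + E →
  SuperEdgeGraceful (RT as)
superEdgeGraceful-from-gadget as G E gadget evens≡ =
  subst (SuperEdgeGraceful ∘ RT) (assign-sizes odds evens m as)
    (superEdgeGraceful-RT bs (l + E + halfSum as) edges↭ inner↭)
  where
  open IsOddGadget gadget
  l = oddCount as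
  odds = entry (ℤ.0ℤ , ℤ.0ℤ) G
  Ev = symPairs (suc l) E
  evens = entry ℤ.0ℤ Ev
  m = suc l + E
  bs = assign odds evens m as
  S = map proj₁ G
  oddSupply : applyUpTo odds (oddCount as) ≡ G
  oddSupply = trans (cong (applyUpTo odds) (sym size)) (applyUpTo-entry _ G)
  evenSupply : applyUpTo evens (evenCount as) ≡ Ev
  evenSupply = trans (cong (applyUpTo evens) (trans evens≡ (sym (symPairs-length (suc l) E)))) (applyUpTo-entry _ Ev)
  spokes↭ : map spoke bs ↭ S ++ Ev
  spokes↭ = ↭-trans (assign-spokes odds evens m as) (↭-reflexive (cong₂ (λ O V → map proj₁ O ++ V) oddSupply evenSupply))
  leaves↭ : concat (map leafLabels bs) ↭ map proj₂ G ++ symPairs m (halfSum as)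
  leaves↭ = ↭-trans (assign-leaves odds evens m as)
                    (↭-reflexive (cong (λ O → map proj₂ O ++ symPairs m (halfSum as)) oddSupply))
  edges↭ : map spoke bs ++ concat (map leafLabels bs) ↭ symPairs 1 (l + E + halfSum as)
  edges↭ = begin
    map spoke bs ++ concat (map leafLabels bs)
      ↭⟨ ++⁺ spokes↭ leaves↭ ⟩
    (S ++ Ev) ++ (map proj₂ G ++ symPairs m (halfSum as))
      ≡⟨ ListP.++-assoc S Ev _ ⟩
    S ++ Ev ++ map proj₂ G ++ symPairs m (halfSum as)
      ↭⟨ ++⁺ˡ S (shifts Ev (map proj₂ G)) ⟩
    S ++ map proj₂ G ++ Ev ++ symPairs m (halfSum as)
      ≡⟨ ListP.++-assoc S (map proj₂ G) _ ⟨
    (S ++ map proj₂ G) ++ Ev ++ symPairs m (halfSum as)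
      ↭⟨ ++⁺ʳ _ labels ⟩
    symPairs 1 l ++ Ev ++ symPairs m (halfSum as)
      ≡⟨ ListP.++-assoc (symPairs 1 l) Ev _ ⟨
    (symPairs 1 l ++ Ev) ++ symPairs m (halfSum as)
      ≡⟨ cong (_++ symPairs m (halfSum as)) (symPairs-++ 1 l E) ⟨
    symPairs 1 (l + E) ++ symPairs m (halfSum as)
      ≡⟨ symPairs-++ 1 (l + E) (halfSum as) ⟨
    symPairs 1 (l + E + halfSum as) ∎
    where open PermutationReasoning
  spokeTotal : sumℤ (map spoke bs) ≡ sumℤ S
  spokeTotal = begin
    sumℤ (map spoke bs)      ≡⟨ sumℤ-↭ spokes↭ ⟩
    sumℤ (S ++ Ev)           ≡⟨ sumℤ-++ S Ev ⟩
    sumℤ S ℤ.+ sumℤ Ev       ≡⟨ cong (λ t → sumℤ S ℤ.+ t) (pairsBy-sum 1 (suc l) E) ⟩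
    sumℤ S ℤ.+ ℤ.0ℤ          ≡⟨ ℤP.+-identityʳ (sumℤ S) ⟩
    sumℤ S ∎
    where open ≡-Reasoning
  inner↭ : sumℤ (map spoke bs) ∷ map branchSum bs ↭ ℤ.0ℤ ∷ map spoke bs
  inner↭ = begin
    sumℤ (map spoke bs) ∷ map branchSum bs ≡⟨ cong (_∷ map branchSum bs) spokeTotal ⟩
    sumℤ S ∷ map branchSum bs
      ↭⟨ ↭-prep (sumℤ S) (↭-trans (assign-branchSums odds evens m as)
                                   (↭-reflexive (cong₂ (λ O V → map pairSum O ++ V) oddSupply evenSupply))) ⟩
    (sumℤ S ∷ map pairSum G) ++ Ev ↭⟨ ++⁺ʳ Ev sums ⟩
    ℤ.0ℤ ∷ S ++ Ev                ↭⟨ ↭-prep ℤ.0ℤ spokes↭ ⟨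
    ℤ.0ℤ ∷ map spoke bs ∎
    where open PermutationReasoning

gadgetPairs : ℕ → ℕ → List (ℤ × ℤ)
gadgetPairs o zero    = []
gadgetPairs o (suc d) = (+ o , - + (suc d + suc d)) ∷ (- + o , + (suc d + suc d)) ∷ gadgetPairs (2 + o) d

gadgetPairs-length : ∀ o d → length (gadgetPairs o d) ≡ d + d
gadgetPairs-length o zero    = refl
gadgetPairs-length o (suc d) = trans (cong (λ n → suc (suc n)) (gadgetPairs-length (2 + o) d)) (sym (cong suc (ℕP.+-suc d d)))

gadgetPairs-spokes : ∀ o d → map proj₁ (gadgetPairs o d) ≡ pairsBy 2 o d
gadgetPairs-spokes o zero    = refl
gadgetPairs-spokes o (suc d) = cong (λ xs → + o ∷ - + o ∷ xs) (gadgetPairs-spokes (2 + o) d)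

gadgetPairs-leaves : ∀ o d → map proj₂ (gadgetPairs o d) ↭ pairsBy 2 2 d
gadgetPairs-leaves o zero    = ↭-refl
gadgetPairs-leaves o (suc d) = begin
  - + D ∷ + D ∷ map proj₂ (gadgetPairs (2 + o) d) ↭⟨ ↭-swap (- + D) (+ D) (gadgetPairs-leaves (2 + o) d) ⟩
  pm (+ D) ++ pairsBy 2 2 d                     ↭⟨ ++-comm (pm (+ D)) (pairsBy 2 2 d) ⟩
  pairsBy 2 2 d ++ pm (+ D)                     ≡⟨ cong (λ n → pairsBy 2 2 d ++ pm (+ n)) D≡ ⟨
  pairsBy 2 2 d ++ pm (+ (d * 2 + 2))           ≡⟨ pairsBy-snoc 2 2 d ⟨
  pairsBy 2 2 (suc d) ∎
  where
  open PermutationReasoning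
  D = suc d + suc d
  D≡ : d * 2 + 2 ≡ D
  D≡ = doubling d
    where
    doubling : ∀ d → d * 2 + 2 ≡ suc d + suc d
    doubling = ℕSolver.solve-∀

pairsStep4 : ℤ → ℕ → List ℤ
pairsStep4 x zero    = []
pairsStep4 x (suc k) = x ∷ - x ∷ pairsStep4 (x ℤ.+ + 4) k

pairsStep4-snoc : ∀ x k → pairsStep4 x (suc k) ≡ pairsStep4 x k ++ pm (x ℤ.+ + (k * 4))
pairsStep4-snoc x zero    = cong pm (sym (ℤP.+-identityʳ x))
pairsStep4-snoc x (suc k) = cong (λ xs → x ∷ - x ∷ xs)
  (trans (pairsStep4-snoc (x ℤ.+ + 4) k) (cong (λ y → pairsStep4 (x ℤ.+ + 4) k ++ pm y) (ℤP.+-assoc x (+ 4) (+ (k * 4)))))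

gadgetPairs-sums : ∀ o d → map pairSum (gadgetPairs o d) ≡ pairsStep4 (+ o ℤ.+ - + (d + d)) d
gadgetPairs-sums o zero    = refl
gadgetPairs-sums o (suc d) = cong₂ (λ y xs → + o ℤ.+ - + D ∷ y ∷ xs) (negate (+ o) (+ D))
  (trans (gadgetPairs-sums (2 + o) d) (cong (λ x → pairsStep4 x d) shift4))
  where
  D = suc d + suc d
  negate : ∀ a b → - a ℤ.+ b ≡ - (a ℤ.+ - b)
  negate = solve-∀
  step : ∀ a e → (+ 2 ℤ.+ a) ℤ.+ - e ≡ (a ℤ.+ - (e ℤ.+ + 2)) ℤ.+ + 4
  step = solve-∀
  shift4 : + (2 + o) ℤ.+ - + (d + d) ≡ (+ o ℤ.+ - + D) ℤ.+ + 4
  shift4 = trans (step (+ o) (+ (d + d))) (cong (λ n → (+ o ℤ.+ - + n) ℤ.+ + 4) (doubling d))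
    where
    doubling : ∀ d → d + d + 2 ≡ suc d + suc d
    doubling = ℕSolver.solve-∀

-- Starting value 1 - 2P of the gadget sums.
centre : ℕ → ℤ
centre P = + 1 ℤ.+ - + (P + P)

double-plus4 : ∀ P → + (suc (suc P) + suc (suc P)) ≡ + (P + P) ℤ.+ + 4
double-plus4 P = trans (cong +_ (lemma P)) (ℤP.pos-+ (P + P) 4)
  where lemma : ∀ P → suc (suc P) + suc (suc P) ≡ P + P + 4
        lemma = ℕSolver.solve-∀

centre-advance : ∀ P → centre (suc (suc P)) ℤ.+ + 4 ≡ centre P
centre-advance P = trans (cong (λ z → (+ 1 ℤ.+ - z) ℤ.+ + 4) (double-plus4 P)) (ring (+ (P + P)))
  where ring : ∀ e → (+ 1 ℤ.+ - (e ℤ.+ + 4)) ℤ.+ + 4 ≡ + 1 ℤ.+ - e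
        ring = solve-∀

centre-front : ∀ P → centre (suc (suc P)) ≡ - + (suc P * 2 + 1)
centre-front P = trans (cong (λ z → + 1 ℤ.+ - z) (double-plus4 P)) (trans (ring (+ (P + P))) (cong -_ (sym c≡)))
  where ring : ∀ e → + 1 ℤ.+ - (e ℤ.+ + 4) ≡ - (e ℤ.+ + 3)
        ring = solve-∀
        lemma : ∀ P → suc P * 2 + 1 ≡ P + P + 3
        lemma = ℕSolver.solve-∀
        c≡ : + (suc P * 2 + 1) ≡ + (P + P) ℤ.+ + 3
        c≡ = trans (cong +_ (lemma P)) (ℤP.pos-+ (P + P) 3)

centre-back : ∀ P → centre P ℤ.+ + (P * 4) ≡ + (P * 2 + 1)
centre-back P = begin
  (+ 1 ℤ.+ - e) ℤ.+ + (P * 4)  ≡⟨ cong (λ z → (+ 1 ℤ.+ - e) ℤ.+ z) 4P≡ ⟩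
  (+ 1 ℤ.+ - e) ℤ.+ (e ℤ.+ e)  ≡⟨ ring e ⟩
  e ℤ.+ + 1                    ≡⟨ trans (cong +_ (sym (twofold P))) (ℤP.pos-+ (P + P) 1) ⟨
  + (P * 2 + 1)                ∎
  where e = + (P + P)
        ring : ∀ e → (+ 1 ℤ.+ - e) ℤ.+ (e ℤ.+ e) ≡ e ℤ.+ + 1
        ring = solve-∀
        fourfold : ∀ P → P * 4 ≡ P + P + (P + P)
        fourfold = ℕSolver.solve-∀
        4P≡ : + (P * 4) ≡ e ℤ.+ e
        4P≡ = trans (cong +_ (fourfold P)) (ℤP.pos-+ (P + P) (P + P))
        twofold : ∀ P → P + P + 1 ≡ P * 2 + 1
        twofold = ℕSolver.solve-∀
        open ≡-Reasoning

-- Two-step induction: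
-- passing from P to P + 2 adds ±(2P+3) in front and ±(2P+1) at the back.
centredStep4 : ∀ P → pairsStep4 (centre P) P ↭ pairsBy 2 1 P
centredStep4 zero          = ↭-refl
centredStep4 (suc zero)    = ↭-swap _ _ ↭-refl
centredStep4 (suc (suc P)) = begin
  centre Q ∷ - centre Q ∷ pairsStep4 (centre Q ℤ.+ + 4) (suc P)
    ≡⟨ cong (λ x → centre Q ∷ - centre Q ∷ pairsStep4 x (suc P)) (centre-advance P) ⟩
  centre Q ∷ - centre Q ∷ pairsStep4 (centre P) (suc P)
    ≡⟨ cong (λ xs → centre Q ∷ - centre Q ∷ xs) (pairsStep4-snoc (centre P) P) ⟩
  centre Q ∷ - centre Q ∷ pairsStep4 (centre P) P ++ pm (centre P ℤ.+ + (P * 4))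
    ↭⟨ ↭-prep (centre Q) (↭-prep (- centre Q) (++⁺ʳ _ (centredStep4 P))) ⟩
  centre Q ∷ - centre Q ∷ pairsBy 2 1 P ++ pm (centre P ℤ.+ + (P * 4))
    ≡⟨ cong₂ (λ x y → x ∷ y ∷ pairsBy 2 1 P ++ pm (centre P ℤ.+ + (P * 4)))
             (centre-front P) (trans (cong -_ (centre-front P)) (ℤP.neg-involutive _)) ⟩
  pm (- c) ++ pairsBy 2 1 P ++ pm (centre P ℤ.+ + (P * 4))
    ↭⟨ ↭-swap (- c) c ↭-refl ⟩
  pm c ++ pairsBy 2 1 P ++ pm (centre P ℤ.+ + (P * 4))
    ↭⟨ ++-comm (pm c) _ ⟩
  (pairsBy 2 1 P ++ pm (centre P ℤ.+ + (P * 4))) ++ pm c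
    ≡⟨ cong (λ x → (pairsBy 2 1 P ++ pm x) ++ pm c) (centre-back P) ⟩
  (pairsBy 2 1 P ++ pm (+ (P * 2 + 1))) ++ pm c
    ≡⟨ trans (pairsBy-snoc 2 1 (suc P)) (cong (_++ pm c) (pairsBy-snoc 2 1 P)) ⟨
  pairsBy 2 1 (suc (suc P)) ∎
  where
  open PermutationReasoning
  Q = suc (suc P)
  c = + (suc P * 2 + 1)

oddGadget : ℕ → List (ℤ × ℤ)
oddGadget P = (- + suc (P + P) , + suc (P + P)) ∷ gadgetPairs 1 P

oddGadget-valid : ∀ P → IsOddGadget (suc (P + P)) (oddGadget P)
oddGadget-valid P = record
  { size   = cong suc (gadgetPairs-length 1 P)
  ; labels = labels
  ; sums   = sums
  }
  where
  open PermutationReasoning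
  l = suc (P + P)
  GP = gadgetPairs 1 P
  S = map proj₁ GP
  labels : (- + l ∷ S) ++ (+ l ∷ map proj₂ GP) ↭ symPairs 1 l
  labels = begin
    - + l ∷ S ++ + l ∷ map proj₂ GP
      ↭⟨ ↭-prep (- + l) (shift (+ l) S (map proj₂ GP)) ⟩
    - + l ∷ + l ∷ S ++ map proj₂ GP
      ↭⟨ ↭-swap (- + l) (+ l) (++⁺ (↭-reflexive (gadgetPairs-spokes 1 P)) (gadgetPairs-leaves 1 P)) ⟩
    pm (+ l) ++ pairsBy 2 1 P ++ pairsBy 2 2 P
      ↭⟨ ++-comm (pm (+ l)) _ ⟩
    (pairsBy 2 1 P ++ pairsBy 2 2 P) ++ pm (+ l)
      ↭⟨ ++⁺ʳ (pm (+ l)) (symPairs-interleave 1 P) ⟨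
    symPairs 1 (P + P) ++ pm (+ l)
      ≡⟨ symPairs-++ 1 (P + P) 1 ⟨
    symPairs 1 (P + P + 1)
      ≡⟨ cong (symPairs 1) (ℕP.+-comm (P + P) 1) ⟩
    symPairs 1 l ∎
  sums : sumℤ (- + l ∷ S) ∷ pairSum (- + l , + l) ∷ map pairSum GP ↭ ℤ.0ℤ ∷ - + l ∷ S
  sums = begin
    sumℤ (- + l ∷ S) ∷ pairSum (- + l , + l) ∷ map pairSum GP
      ≡⟨ cong₂ (λ x y → x ∷ y ∷ map pairSum GP) spokeTotal (ℤP.+-inverseˡ (+ l)) ⟩
    - + l ∷ ℤ.0ℤ ∷ map pairSum GP
      ↭⟨ ↭-swap (- + l) ℤ.0ℤ (↭-trans (↭-reflexive (gadgetPairs-sums 1 P)) (centredStep4 P)) ⟩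
    ℤ.0ℤ ∷ - + l ∷ pairsBy 2 1 P
      ≡⟨ cong (λ xs → ℤ.0ℤ ∷ - + l ∷ xs) (gadgetPairs-spokes 1 P) ⟨
    ℤ.0ℤ ∷ - + l ∷ S ∎
    where
    spokeTotal : sumℤ (- + l ∷ S) ≡ - + l
    spokeTotal = trans (cong (λ t → - + l ℤ.+ t) (trans (cong sumℤ (gadgetPairs-spokes 1 P)) (pairsBy-sum 2 1 P)))
                       (ℤP.+-identityʳ (- + l))

countOdd≡oddCount : ∀ as → countOdd as ≡ oddCount as
countOdd≡oddCount []       = refl
countOdd≡oddCount (a ∷ as) with parity a
... | even h rewrite double%2 h     = countOdd≡oddCount as
... | odd h  rewrite suc-double%2 h = cong suc (countOdd≡oddCount as)

countEven≡evenCount : ∀ as → countZero as + countPosEven as ≡ evenCount as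
countEven≡evenCount []       = refl
countEven≡evenCount (a ∷ as) with parity a
... | even zero    = cong suc (countEven≡evenCount as)
... | even (suc h) rewrite double%2 (suc h) = trans (ℕP.+-suc (countZero as) (countPosEven as)) (cong suc (countEven≡evenCount as))
... | odd h  rewrite suc-double%2 h = countEven≡evenCount as

even-+ : ∀ {m n} → Even m → Even n → Even (m + n)
even-+ {m} {n} m%2≡0 n%2≡0 = trans (%-distribˡ-+ m n 2) (cong₂ (λ x y → (x + y) % 2) m%2≡0 n%2≡0)

even⇒double : ∀ n → Even n → ∃ λ E → n ≡ E + E
even⇒double n n%2≡0 with parity n
... | even h = h , refl
... | odd h  with () ← trans (sym (suc-double%2 h)) n%2≡0

odd⇒suc-double : ∀ n → Odd n → ∃ λ P → n ≡ suc (P + P)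
odd⇒suc-double n n%2≡1 with parity n
... | odd h  = h , refl
... | even h with () ← trans (sym (double%2 h)) n%2≡1

-- l = oddCount as = 2P + 1 and j + k = evenCount as = 2E; the odd gadget for P
-- then yields the labelling.
lemma9 : (as : List ℕ) → Even (countZero as) → Even (countPosEven as) → Odd (countOdd as) → 3 ≤ countPosEven as + countOdd as → SuperEdgeGraceful (RT as)
lemma9 as zerosEven posEvensEven oddsOdd _
  with P , oddCount≡ ← odd⇒suc-double (oddCount as) (subst Odd (countOdd≡oddCount as) oddsOdd)
     | E , evenCount≡ ← even⇒double (evenCount as)
                           (subst Even (countEven≡evenCount as) (even-+ {countZero as} zerosEven posEvensEven))
  = superEdgeGraceful-from-gadget as (oddGadget P) E gadget evenCount≡
  where
  gadget : IsOddGadget (oddCount as) (oddGadget P)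
  gadget = subst (λ l → IsOddGadget l (oddGadget P)) (sym oddCount≡) (oddGadget-valid P)
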